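{- Let $G$ be a finite graph that is a disjoint union of $\ell$ trees whose orders are $\lambda_1\geq\lambda_2\geq\dots\geq\lambda_\ell$. Then for any proper edge coloring $\kappa:E(G)\to[k]$, the product $\tau_{\pi(1)}\tau_{\pi(2)}\cdots\tau_{\pi(k)}$ of all the generators, for any permutation $\pi$ of $[k]$, has cycle type $\lambda=(\lambda_1,\dots,\lambda_\ell)$.
   Context: A proper edge coloring of $G$ on $k$ colors is a surjective map $\kappa:E(G)\to[k]$ such that edges sharing a vertex receive different colors. For $a\in[k]$, $\tau_a\in S_{V(G)}$ is the product of the transpositions $(i,j)$ over all edges $\{i,j\}$ colored $a$. -}

module Defs where

open import Data.Nat using (ℕ; zero; suc; _<_; _≤_)
open import Data.Fin using (Fin; zero; suc; toℕ; inject₁; fromℕ; _≟_)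
open import Data.List using (List; foldr; filter; length)
open import Data.List.Base using ()
open import Data.Fin.Base using ()
open import Data.List using ()
open import Data.Product using (Σ; ∃; ∃-syntax; _×_; _,_; proj₁; proj₂)
open import Data.Sum using (_⊎_)
open import Function using (_∘_; id; Injective)
open import Relation.Binary.PropositionalEquality using (_≡_; _≢_)
open import Relation.Binary.Construct.Closure.ReflexiveTransitive using (Star)
open import Relation.Nullary using (¬_; yes; no)
open import Data.Fin.Permutation using (Permutation′; _⟨$⟩ʳ_)
import Data.List as L

allFin : (n : ℕ) → List (Fin n)
allFin n = L.allFin n

-- Edge i is the pair (u , v) = edge i with toℕ u < toℕ v (so no loops,
-- each unordered edge {u,v} written canonically), edges pairwise distinct.

record Graph (n : ℕ) : Set where
  field
    m        : ℕ
    edge     : Fin m → Fin n × Fin n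
    ordered  : ∀ i → toℕ (proj₁ (edge i)) < toℕ (proj₂ (edge i))
    distinct : Injective _≡_ _≡_ edge
open Graph public

Adj : ∀ {n} (G : Graph n) → Fin n → Fin n → Set
Adj G u v = ∃[ i ] (edge G i ≡ (u , v) ⊎ edge G i ≡ (v , u))

Connected : ∀ {n} (G : Graph n) → Fin n → Fin n → Set
Connected G = Star (Adj G)

-- a cycle in G: distinct vertices f 0, …, f (r+2) (length r+3 ≥ 3),
-- consecutive ones adjacent, and the last adjacent to the first
record GraphCycle {n} (G : Graph n) : Set where
  field
    r      : ℕ
    vtx    : Fin (suc (suc (suc r))) → Fin n
    inj    : Injective _≡_ _≡_ vtx
    step   : ∀ (i : Fin (suc (suc r))) → Adj G (vtx (inject₁ i)) (vtx (suc i))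
    close  : Adj G (vtx (fromℕ (suc (suc r)))) (vtx zero)

Acyclic : ∀ {n} → Graph n → Set
Acyclic G = ¬ GraphCycle G

fiberSize : ∀ {n ℓ} → (Fin n → Fin ℓ) → Fin ℓ → ℕ
fiberSize {n} d j = length (filter (λ v → d v ≟ j) (allFin n))

-- G is the disjoint union of ℓ trees T_1,…,T_ℓ of orders λ_1,…,λ_ℓ:
-- c assigns each vertex to its tree; each T_t is nonempty, has λ t vertices,
-- there are no edges between different trees, each T_t is connected,
-- and G (hence every T_t) has no cycle.
record DisjointUnionOfTrees {n} (G : Graph n) (ℓ : ℕ) (λs : Fin ℓ → ℕ) : Set where
  field
    c         : Fin n → Fin ℓ
    nonempty  : ∀ t → ∃[ v ] c v ≡ t
    order     : ∀ t → fiberSize c t ≡ λs t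
    noCross   : ∀ u v → Adj G u v → c u ≡ c v
    connected : ∀ u v → c u ≡ c v → Connected G u v
    acyclic   : Acyclic G

ShareVertex : ∀ {n} → Fin n × Fin n → Fin n × Fin n → Set
ShareVertex (a , b) (c , d) = (a ≡ c ⊎ a ≡ d) ⊎ (b ≡ c ⊎ b ≡ d)

record ProperEdgeColoring {n} (G : Graph n) (k : ℕ) (κ : Fin (m G) → Fin k) : Set where
  field
    surjective : ∀ a → ∃[ i ] κ i ≡ a
    proper     : ∀ i j → i ≢ j → ShareVertex (edge G i) (edge G j) → κ i ≢ κ j

transposition : ∀ {n} → Fin n × Fin n → Fin n → Fin n
transposition (u , v) x with x ≟ u
... | yes _ = v
... | no _ with x ≟ v
...   | yes _ = u
...   | no _ = x

-- τ_a : product of the transpositions of all edges of colour a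
-- (composition of functions, (f g)(x) = f (g x))
τ : ∀ {n} (G : Graph n) {k} (κ : Fin (m G) → Fin k) → Fin k → Fin n → Fin n
τ G κ a = foldr (λ i f → transposition (edge G i) ∘ f) id
                (filter (λ i → κ i ≟ a) (allFin (m G)))

prod : ∀ {n k} → (Fin k → Fin n → Fin n) → Fin n → Fin n
prod {k = zero}  f = id
prod {k = suc k} f = f zero ∘ prod (f ∘ suc)

coxeterProduct : ∀ {n} (G : Graph n) {k} (κ : Fin (m G) → Fin k) → Permutation′ k → Fin n → Fin n
coxeterProduct G κ π = prod (λ i → τ G κ (π ⟨$⟩ʳ i))

_^[_] : ∀ {A : Set} → (A → A) → ℕ → A → A
f ^[ zero ]  = id
f ^[ suc t ] = f ∘ (f ^[ t ])

-- σ has cycle type (λ_1,…,λ_ℓ): the cycles (orbits) of σ can be labelled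
-- O_1,…,O_ℓ (d v = label of the cycle containing v), each nonempty, with |O_j| = λ_j.
record HasCycleType {n} (σ : Fin n → Fin n) (ℓ : ℕ) (λs : Fin ℓ → ℕ) : Set where
  field
    d        : Fin n → Fin ℓ
    orbits   : ∀ u v → (d u ≡ d v → ∃[ t ] (σ ^[ t ]) u ≡ v)
                     × ((∃[ t ] (σ ^[ t ]) u ≡ v) → d u ≡ d v)
    nonempty : ∀ j → ∃[ v ] d v ≡ j
    size     : ∀ j → fiberSize d j ≡ λs j

Decreasing : ∀ {ℓ} → (Fin ℓ → ℕ) → Set
Decreasing {ℓ} λs = ∀ (i j : Fin ℓ) → toℕ i ≤ toℕ j → λs j ≤ λs i

{-# OPTIONS --safe #-}
module Submission where

-- If a and b lie in different cycles of a permutation σ, then (a b) ∘ σ merges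
-- those two cycles and keeps all other cycles. Multiply the transpositions of the
-- edges of a forest in any order: when an edge {a, b} is multiplied in, the
-- product so far moves vertices only along edges already used, so a and b
-- cannot yet share a cycle, as a path between them would close a cycle of the
-- forest with {a, b}. Hence the cycles of the full product are exactly the
-- vertex sets of the trees. The colouring only fixes one such order.

open import Defs
open import Data.Nat as ℕ using (ℕ; zero; suc; _+_; _∸_)
open import Data.Nat.Properties using (n<1+n; m+[n∸m]≡n; m<n⇒0<n∸m; m∸n+n≡m; <⇒≤; +-comm; <-irrefl; <-asym)
open import Data.Fin using (Fin; zero; suc; toℕ; inject₁; fromℕ; _≟_)
open import Data.Fin.Properties using (pigeonhole; suc-injective)
open import Data.Fin.Permutation using (Permutation′; _⟨$⟩ʳ_; _⟨$⟩ˡ_; inverseʳ; inverseˡ)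
open import Data.Product using (Σ; ∃-syntax; _×_; _,_; proj₁; proj₂)
open import Data.Sum using (_⊎_; inj₁; inj₂)
open import Data.Empty using (⊥-elim)
open import Data.List using (List; []; _∷_; foldr; filter; _++_)
open import Data.List.Membership.Propositional using (_∈_; _∉_)
open import Data.List.Membership.Propositional.Properties
  using (∈-filter⁺; ∈-filter⁻; ∈-allFin; ∈-++⁺ˡ; ∈-++⁺ʳ; ∈-++⁻)
open import Data.List.Relation.Unary.Any using (here; there)
open import Data.List.Relation.Unary.All as All using ()
open import Data.List.Relation.Unary.All.Properties.Core using (¬Any⇒All¬)
open import Data.List.Relation.Unary.AllPairs using ([]; _∷_)
open import Data.List.Relation.Unary.Unique.Propositional using (Unique)
import Data.List.Relation.Unary.Unique.Propositional.Properties as Unique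
open import Function using (_∘_; id; Injective)
open import Relation.Binary.PropositionalEquality
open import Relation.Binary.Construct.Closure.ReflexiveTransitive as Star using (Star; ε; _◅_; _◅◅_)
open import Relation.Nullary using (¬_; yes; no)

module _ {n} (a b : Fin n) where

  transposition-fst : transposition (a , b) a ≡ b
  transposition-fst with a ≟ a
  ... | yes _  = refl
  ... | no a≢a = ⊥-elim (a≢a refl)

  transposition-snd : transposition (a , b) b ≡ a
  transposition-snd with b ≟ a
  ... | yes b≡a = b≡a
  ... | no _ with b ≟ b
  ...   | yes _  = refl
  ...   | no b≢b = ⊥-elim (b≢b refl)

  transposition-fixes : ∀ {x} → x ≢ a → x ≢ b → transposition (a , b) x ≡ x
  transposition-fixes {x} x≢a x≢b with x ≟ a
  ... | yes x≡a = ⊥-elim (x≢a x≡a)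
  ... | no _ with x ≟ b
  ...   | yes x≡b = ⊥-elim (x≢b x≡b)
  ...   | no _    = refl

  transposition-involutive : ∀ x → transposition (a , b) (transposition (a , b) x) ≡ x
  transposition-involutive x with x ≟ a
  ... | yes refl = transposition-snd
  ... | no x≢a with x ≟ b
  ...   | yes refl = transposition-fst
  ...   | no x≢b   = transposition-fixes x≢a x≢b

  transposition-injective : Injective _≡_ _≡_ (transposition (a , b))
  transposition-injective {x} {y} e =
    trans (sym (transposition-involutive x))
          (trans (cong (transposition (a , b)) e) (transposition-involutive y))

iterate-suc : ∀ {A : Set} (f : A → A) t x → (f ^[ suc t ]) x ≡ (f ^[ t ]) (f x)
iterate-suc f zero    x = refl
iterate-suc f (suc t) x = cong f (iterate-suc f t x)

iterate-+ : ∀ {A : Set} (f : A → A) s t x → (f ^[ s + t ]) x ≡ (f ^[ s ]) ((f ^[ t ]) x)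
iterate-+ f zero    t x = refl
iterate-+ f (suc s) t x = cong f (iterate-+ f s t x)

iterate-injective : ∀ {A : Set} (f : A → A) → Injective _≡_ _≡_ f → ∀ t → Injective _≡_ _≡_ (f ^[ t ])
iterate-injective f f-inj zero    e = e
iterate-injective f f-inj (suc t) e = iterate-injective f f-inj t (f-inj e)

-- Among x, f x, …, fⁿ x two points coincide; injectivity cancels the smaller power.
iterate-returns : ∀ {n} (f : Fin n → Fin n) → Injective _≡_ _≡_ f → ∀ x → ∃[ q ] (f ^[ suc q ]) x ≡ x
iterate-returns {n} f f-inj x with pigeonhole (n<1+n n) (λ (i : Fin (suc n)) → (f ^[ toℕ i ]) x)
... | i , j , i<j , fⁱx≡fʲx = q , sym (iterate-injective f f-inj (toℕ i) fⁱx≡fⁱ⁺ᵠ⁺¹x)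
  where
  q = toℕ j ∸ toℕ i ∸ 1
  j≡i+1+q : toℕ j ≡ toℕ i + suc q
  j≡i+1+q = begin
    toℕ j                     ≡⟨ sym (m∸n+n≡m (<⇒≤ i<j)) ⟩
    toℕ j ∸ toℕ i + toℕ i     ≡⟨ cong (_+ toℕ i) (sym (m+[n∸m]≡n (m<n⇒0<n∸m i<j))) ⟩
    suc q + toℕ i             ≡⟨ +-comm (suc q) (toℕ i) ⟩
    toℕ i + suc q             ∎
    where open ≡-Reasoning
  fⁱx≡fⁱ⁺ᵠ⁺¹x : (f ^[ toℕ i ]) x ≡ (f ^[ toℕ i ]) ((f ^[ suc q ]) x)
  fⁱx≡fⁱ⁺ᵠ⁺¹x = begin
    (f ^[ toℕ i ]) x                  ≡⟨ fⁱx≡fʲx ⟩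
    (f ^[ toℕ j ]) x                  ≡⟨ cong (λ t → (f ^[ t ]) x) j≡i+1+q ⟩
    (f ^[ toℕ i + suc q ]) x          ≡⟨ iterate-+ f (toℕ i) (suc q) x ⟩
    (f ^[ toℕ i ]) ((f ^[ suc q ]) x) ∎
    where open ≡-Reasoning

Reach : ∀ {A : Set} → (A → A) → A → A → Set
Reach σ = Star (λ x y → σ x ≡ y)

module _ {A : Set} (σ : A → A) where

  Reach⇒iterate : ∀ {u v} → Reach σ u v → ∃[ t ] (σ ^[ t ]) u ≡ v
  Reach⇒iterate ε = 0 , refl
  Reach⇒iterate (refl ◅ r) with Reach⇒iterate r
  ... | t , σᵗ⁺¹u≡v = suc t , trans (iterate-suc σ t _) σᵗ⁺¹u≡v

  iterate⇒Reach : ∀ t u → Reach σ u ((σ ^[ t ]) u)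
  iterate⇒Reach zero    u = ε
  iterate⇒Reach (suc t) u = subst (Reach σ u) (sym (iterate-suc σ t u)) (refl ◅ iterate⇒Reach t (σ u))

  Reach-invariant : ∀ {B : Set} (c : A → B) → (∀ x → c (σ x) ≡ c x) → ∀ {u v} → Reach σ u v → c u ≡ c v
  Reach-invariant c c-inv ε          = refl
  Reach-invariant c c-inv (refl ◅ r) = trans (sym (c-inv _)) (Reach-invariant c c-inv r)

Reach-cong : ∀ {A : Set} {σ ρ : A → A} → σ ≗ ρ → ∀ {u v} → Reach ρ u v → Reach σ u v
Reach-cong σ≗ρ = Star.map (trans (σ≗ρ _))

Reach-sym : ∀ {n} (σ : Fin n → Fin n) → Injective _≡_ _≡_ σ → ∀ {u v} → Reach σ u v → Reach σ v u
Reach-sym σ σ-inj ε          = ε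
Reach-sym σ σ-inj (refl ◅ r) = Reach-sym σ σ-inj r ◅◅ back _
  where
  back : ∀ x → Reach σ (σ x) x
  back x with iterate-returns σ σ-inj x
  ... | q , σ^q⁺¹x≡x = subst (Reach σ (σ x)) (trans (sym (iterate-suc σ q x)) σ^q⁺¹x≡x) (iterate⇒Reach σ q (σ x))

module MergeCycles {n} (a b : Fin n) (σ : Fin n → Fin n) (σ-inj : Injective _≡_ _≡_ σ)
                   (a↛b : ¬ Reach σ a b) where

  ρ : Fin n → Fin n
  ρ = transposition (a , b) ∘ σ

  ρ-injective : Injective _≡_ _≡_ ρ
  ρ-injective = σ-inj ∘ transposition-injective a b

  private
    ρ-step-a : ∀ {x} → σ x ≡ a → ρ x ≡ b
    ρ-step-a σx≡a = trans (cong (transposition (a , b)) σx≡a) (transposition-fst a b)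

    ρ-step-b : ∀ {x} → σ x ≡ b → ρ x ≡ a
    ρ-step-b σx≡b = trans (cong (transposition (a , b)) σx≡b) (transposition-snd a b)

    -- ρ follows the σ-cycle of a until that cycle returns to a; b is never met on the way.
    follows-cycle : ∀ t → Reach ρ a ((σ ^[ t ]) a) ⊎ Reach ρ a b
    follows-cycle zero = inj₁ ε
    follows-cycle (suc t) with follows-cycle t
    ... | inj₂ a↝b = inj₂ a↝b
    ... | inj₁ a↝σᵗa with (σ ^[ suc t ]) a ≟ a
    ...   | yes σᵗ⁺¹a≡a = inj₂ (a↝σᵗa ◅◅ ρ-step-a σᵗ⁺¹a≡a ◅ ε)
    ...   | no σᵗ⁺¹a≢a with (σ ^[ suc t ]) a ≟ b
    ...     | yes σᵗ⁺¹a≡b = ⊥-elim (a↛b (subst (Reach σ a) σᵗ⁺¹a≡b (iterate⇒Reach σ (suc t) a)))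
    ...     | no σᵗ⁺¹a≢b  = inj₁ (a↝σᵗa ◅◅ transposition-fixes a b σᵗ⁺¹a≢a σᵗ⁺¹a≢b ◅ ε)

  joins : Reach ρ a b
  joins with iterate-returns σ σ-inj a
  ... | q , σ^q⁺¹a≡a with follows-cycle q
  ...   | inj₂ a↝b   = a↝b
  ...   | inj₁ a↝σᵠa = a↝σᵠa ◅◅ ρ-step-a σ^q⁺¹a≡a ◅ ε

  private
    step : ∀ x → Reach ρ x (σ x)
    step x with σ x ≟ a
    ... | yes σx≡a = subst (Reach ρ x) (sym σx≡a) (ρ-step-a σx≡a ◅ Reach-sym ρ ρ-injective joins)
    ... | no σx≢a with σ x ≟ b
    ...   | yes σx≡b = subst (Reach ρ x) (sym σx≡b) (ρ-step-b σx≡b ◅ joins)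
    ...   | no σx≢b  = transposition-fixes a b σx≢a σx≢b ◅ ε

  Reach-preserved : ∀ {x y} → Reach σ x y → Reach ρ x y
  Reach-preserved ε          = ε
  Reach-preserved (refl ◅ r) = step _ ◅◅ Reach-preserved r

module SimplePaths {n} (R : Fin n → Fin n → Set) where
  open import Data.List.Membership.DecPropositional (_≟_ {n}) using (_∈?_)

  data WalkThrough : Fin n → Fin n → List (Fin n) → Set where
    [_] : ∀ y → WalkThrough y y (y ∷ [])
    _∷_ : ∀ {x z y vs} → R x z → WalkThrough z y vs → WalkThrough x y (x ∷ vs)

  private
    shortcut : ∀ {x z y vs} → WalkThrough z y vs → Unique vs → x ∈ vs →
               ∃[ ws ] (WalkThrough x y ws × Unique ws)
    shortcut [ y ]   u        (here refl) = _ , [ y ] , u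
    shortcut (r ∷ w) u        (here refl) = _ , r ∷ w , u
    shortcut (r ∷ w) (_ ∷ u) (there x∈)  = shortcut w u x∈

  Star⇒simpleWalk : ∀ {x y} → Star R x y → ∃[ vs ] (WalkThrough x y vs × Unique vs)
  Star⇒simpleWalk {y = y} ε = y ∷ [] , [ y ] , All.[] ∷ []
  Star⇒simpleWalk {x = x} (r ◅ s) with Star⇒simpleWalk s
  ... | vs , w , u with x ∈? vs
  ...   | yes x∈vs = shortcut w u x∈vs
  ...   | no  x∉vs = x ∷ vs , r ∷ w , ¬Any⇒All¬ vs x∉vs ∷ u

  record SimplePath (x y : Fin n) : Set where
    field
      len     : ℕ
      vtx     : Fin (suc len) → Fin n
      start   : vtx zero ≡ x
      end     : vtx (fromℕ len) ≡ y
      step    : ∀ i → R (vtx (inject₁ i)) (vtx (suc i))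
      vtx-inj : Injective _≡_ _≡_ vtx

  simpleWalk⇒SimplePath : ∀ {x y vs} → WalkThrough x y vs → Unique vs →
                          Σ (SimplePath x y) λ P → ∀ i → SimplePath.vtx P i ∈ vs
  simpleWalk⇒SimplePath [ y ] _ =
    record { len = 0 ; vtx = λ _ → y ; start = refl ; end = refl ; step = λ ()
           ; vtx-inj = λ { {zero} {zero} _ → refl } }
    , λ { zero → here refl }
  simpleWalk⇒SimplePath {x = x} (_∷_ {vs = vs} r w) (x∉vs ∷ u) with simpleWalk⇒SimplePath w u
  ... | P , ∈vs = record { len = suc len ; vtx = vtx′ ; start = refl ; end = end
                         ; step = step′ ; vtx-inj = vtx′-inj }
                , ∈x∷vs
    where
    open SimplePath P
    vtx′ : Fin (suc (suc len)) → Fin n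
    vtx′ zero    = x
    vtx′ (suc i) = vtx i
    step′ : ∀ i → R (vtx′ (inject₁ i)) (vtx′ (suc i))
    step′ zero    = subst (R x) (sym start) r
    step′ (suc i) = step i
    vtx′-inj : Injective _≡_ _≡_ vtx′
    vtx′-inj {zero}  {zero}  _ = refl
    vtx′-inj {zero}  {suc j} e = ⊥-elim (All.lookup x∉vs (∈vs j) e)
    vtx′-inj {suc i} {zero}  e = ⊥-elim (All.lookup x∉vs (∈vs i) (sym e))
    vtx′-inj {suc i} {suc j} e = cong suc (vtx-inj e)
    ∈x∷vs : ∀ i → vtx′ i ∈ (x ∷ vs)
    ∈x∷vs zero    = here refl
    ∈x∷vs (suc i) = there (∈vs i)

  Star⇒SimplePath : ∀ {x y} → Star R x y → SimplePath x y
  Star⇒SimplePath s with Star⇒simpleWalk s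
  ... | _ , w , u = proj₁ (simpleWalk⇒SimplePath w u)

module _ {n} (G : Graph n) where

  edgeProduct : List (Fin (m G)) → Fin n → Fin n
  edgeProduct = foldr (λ i f → transposition (edge G i) ∘ f) id

  AdjIn : List (Fin (m G)) → Fin n → Fin n → Set
  AdjIn L u v = ∃[ i ] (i ∈ L × (edge G i ≡ (u , v) ⊎ edge G i ≡ (v , u)))

  edgeProduct-injective : ∀ L → Injective _≡_ _≡_ (edgeProduct L)
  edgeProduct-injective []      e = e
  edgeProduct-injective (i ∷ L) e = edgeProduct-injective L (transposition-injective _ _ e)

  private
    transposition-Adj : ∀ i L → ∀ z → Star (AdjIn (i ∷ L)) z (transposition (edge G i) z)
    transposition-Adj i L z with edge G i in eq
    ... | (a , b) with z ≟ a
    ...   | yes refl = (i , here refl , inj₁ eq) ◅ ε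
    ...   | no _ with z ≟ b
    ...     | yes refl = (i , here refl , inj₂ eq) ◅ ε
    ...     | no _     = ε

    edgeProduct-step-Adj : ∀ L x → Star (AdjIn L) x (edgeProduct L x)
    edgeProduct-step-Adj []      x = ε
    edgeProduct-step-Adj (i ∷ L) x =
      Star.map (λ { (j , j∈L , e) → j , there j∈L , e }) (edgeProduct-step-Adj L x)
      ◅◅ transposition-Adj i L (edgeProduct L x)

  Reach⇒connectedIn : ∀ L {x y} → Reach (edgeProduct L) x y → Star (AdjIn L) x y
  Reach⇒connectedIn L ε          = ε
  Reach⇒connectedIn L (refl ◅ r) = edgeProduct-step-Adj L _ ◅◅ Reach⇒connectedIn L r

  -- A path of length 1 from a to b would use edge e itself (edges are distinct and
  -- oriented), so the simple path has length ≥ 2 and closes a cycle with e.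
  closePath : ∀ {T e a b} → e ∉ T → edge G e ≡ (a , b) → Star (AdjIn T) a b → GraphCycle G
  closePath {T} {e} {a} {b} e∉T eq a⇝b = close (Star⇒SimplePath a⇝b)
    where
    open SimplePaths (AdjIn T)
    Oriented : Fin n × Fin n → Set
    Oriented p = toℕ (proj₁ p) ℕ.< toℕ (proj₂ p)
    a<b : toℕ a ℕ.< toℕ b
    a<b = subst Oriented eq (ordered G e)
    close : SimplePath a b → GraphCycle G
    close record { len = zero ; vtx = vtx ; start = start ; end = end } =
      ⊥-elim (<-irrefl (cong toℕ (trans (sym start) end)) a<b)
    close record { len = suc zero ; vtx = vtx ; start = start ; end = end ; step = step }
      with subst₂ (AdjIn T) start end (step zero)
    ... | j , j∈T , inj₁ ej = ⊥-elim (e∉T (subst (_∈ T) (distinct G (trans ej (sym eq))) j∈T))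
    ... | j , _   , inj₂ ej = ⊥-elim (<-asym a<b (subst Oriented ej (ordered G j)))
    close record { len = suc (suc r) ; vtx = vtx ; start = start ; end = end ; step = step ; vtx-inj = vtx-inj } =
      record { r = r ; vtx = vtx ; inj = vtx-inj
             ; step = λ i → let (j , _ , e) = step i in j , e
             ; close = subst₂ (Adj G) (sym end) (sym start) (e , inj₂ eq) }

  edgeProduct-joins-endpoints : Acyclic G → ∀ L → Unique L → ∀ {i} → i ∈ L →
                                Reach (edgeProduct L) (proj₁ (edge G i)) (proj₂ (edge G i))
  edgeProduct-joins-endpoints acyclic (e ∷ L) (e∉L ∷ u) {i} i∈e∷L with edge G e in eq
  ... | (a , b) = joins-if i∈e∷L
    where
    a↛b : ¬ Reach (edgeProduct L) a b
    a↛b r = acyclic (closePath (λ e∈L → All.lookup e∉L e∈L refl) eq (Reach⇒connectedIn L r))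
    open MergeCycles a b (edgeProduct L) (edgeProduct-injective L) a↛b
    joins-if : i ∈ e ∷ L → Reach ρ (proj₁ (edge G i)) (proj₂ (edge G i))
    joins-if (here refl) = subst (λ p → Reach ρ (proj₁ p) (proj₂ p)) (sym eq) joins
    joins-if (there i∈L) = Reach-preserved (edgeProduct-joins-endpoints acyclic L u i∈L)

  forest-edgeProduct-connects : Acyclic G → ∀ L → Unique L → (∀ i → i ∈ L) →
                                ∀ {u v} → Connected G u v → Reach (edgeProduct L) u v
  forest-edgeProduct-connects acyclic L u all∈ = Star.fold (Reach σ) (λ uv r → adjacent uv ◅◅ r) ε
    where
    σ = edgeProduct L
    endpoints : ∀ i → Reach σ (proj₁ (edge G i)) (proj₂ (edge G i))
    endpoints i = edgeProduct-joins-endpoints acyclic L u (all∈ i)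
    adjacent : ∀ {x y} → Adj G x y → Reach σ x y
    adjacent (i , inj₁ e) = subst (λ p → Reach σ (proj₁ p) (proj₂ p)) e (endpoints i)
    adjacent (i , inj₂ e) = Reach-sym σ (edgeProduct-injective L)
                              (subst (λ p → Reach σ (proj₁ p) (proj₂ p)) e (endpoints i))

  edgeProduct-preserves : ∀ {B : Set} (c : Fin n → B) → (∀ u v → Adj G u v → c u ≡ c v) →
                          ∀ L x → c (edgeProduct L x) ≡ c x
  edgeProduct-preserves c c-const []      x = refl
  edgeProduct-preserves c c-const (i ∷ L) x =
    trans (transposition-preserves (edgeProduct L x)) (edgeProduct-preserves c c-const L x)
    where
    transposition-preserves : ∀ y → c (transposition (edge G i) y) ≡ c y
    transposition-preserves y with edge G i in eq
    ... | (a , b) with y ≟ a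
    ...   | yes refl = sym (c-const y b (i , inj₁ eq))
    ...   | no _ with y ≟ b
    ...     | yes refl = c-const a y (i , inj₁ eq)
    ...     | no _     = refl

module _ {n} (G : Graph n) {k} (κ : Fin (m G) → Fin k) where

  colourClass : Fin k → List (Fin (m G))
  colourClass a = filter (λ i → κ i ≟ a) (allFin (m G))

  edgesByColours : ∀ {k′} → (Fin k′ → Fin k) → List (Fin (m G))
  edgesByColours {zero}   g = []
  edgesByColours {suc k′} g = colourClass (g zero) ++ edgesByColours (g ∘ suc)

  private
    edgeProduct-++ : ∀ A B x → edgeProduct G (A ++ B) x ≡ edgeProduct G A (edgeProduct G B x)
    edgeProduct-++ []      B x = refl
    edgeProduct-++ (i ∷ A) B x = cong (transposition (edge G i)) (edgeProduct-++ A B x)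

    colour-∈-colourClass : ∀ {a i} → i ∈ colourClass a → κ i ≡ a
    colour-∈-colourClass {a} i∈ = proj₂ (∈-filter⁻ (λ i → κ i ≟ a) {xs = allFin (m G)} i∈)

  prod-τ≗edgeProduct : ∀ {k′} (g : Fin k′ → Fin k) → prod (τ G κ ∘ g) ≗ edgeProduct G (edgesByColours g)
  prod-τ≗edgeProduct {zero}   g x = refl
  prod-τ≗edgeProduct {suc k′} g x =
    trans (cong (τ G κ (g zero)) (prod-τ≗edgeProduct (g ∘ suc) x))
          (sym (edgeProduct-++ (colourClass (g zero)) (edgesByColours (g ∘ suc)) x))

  colour-∈-edgesByColours : ∀ {k′} (g : Fin k′ → Fin k) {i} → i ∈ edgesByColours g → ∃[ j ] κ i ≡ g j
  colour-∈-edgesByColours {suc k′} g i∈ with ∈-++⁻ (colourClass (g zero)) i∈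
  ... | inj₁ i∈class = zero , colour-∈-colourClass i∈class
  ... | inj₂ i∈rest  = let (j , κi≡gj) = colour-∈-edgesByColours (g ∘ suc) i∈rest in suc j , κi≡gj

  ∈-edgesByColours : ∀ {k′} (g : Fin k′ → Fin k) i j → κ i ≡ g j → i ∈ edgesByColours g
  ∈-edgesByColours {suc k′} g i zero    κi≡gj = ∈-++⁺ˡ (∈-filter⁺ (λ i → κ i ≟ g zero) (∈-allFin i) κi≡gj)
  ∈-edgesByColours {suc k′} g i (suc j) κi≡gj =
    ∈-++⁺ʳ (colourClass (g zero)) (∈-edgesByColours (g ∘ suc) i j κi≡gj)

  edgesByColours-unique : ∀ {k′} (g : Fin k′ → Fin k) → Injective _≡_ _≡_ g → Unique (edgesByColours g)
  edgesByColours-unique {zero}   g g-inj = []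
  edgesByColours-unique {suc k′} g g-inj =
    Unique.++⁺ (Unique.filter⁺ (λ i → κ i ≟ g zero) (Unique.allFin⁺ (m G)))
               (edgesByColours-unique (g ∘ suc) (suc-injective ∘ g-inj))
               disjoint
    where
    disjoint : ∀ {i} → ¬ (i ∈ colourClass (g zero) × i ∈ edgesByColours (g ∘ suc))
    disjoint (i∈class , i∈rest) with colour-∈-edgesByColours (g ∘ suc) i∈rest
    ... | j , κi≡gj with g-inj (trans (sym (colour-∈-colourClass i∈class)) κi≡gj)
    ...   | ()

  coxeterOrder : Permutation′ k → List (Fin (m G))
  coxeterOrder π = edgesByColours (π ⟨$⟩ʳ_)

  coxeterProduct≗edgeProduct : ∀ π → coxeterProduct G κ π ≗ edgeProduct G (coxeterOrder π)
  coxeterProduct≗edgeProduct π = prod-τ≗edgeProduct (π ⟨$⟩ʳ_)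

  coxeterOrder-unique : ∀ π → Unique (coxeterOrder π)
  coxeterOrder-unique π = edgesByColours-unique (π ⟨$⟩ʳ_) λ {i} {j} e →
    trans (sym (inverseˡ π)) (trans (cong (π ⟨$⟩ˡ_) e) (inverseˡ π))

  ∈-coxeterOrder : ∀ π i → i ∈ coxeterOrder π
  ∈-coxeterOrder π i = ∈-edgesByColours (π ⟨$⟩ʳ_) i (π ⟨$⟩ˡ κ i) (sym (inverseʳ π))

lemma3p7 : ∀ {n : ℕ} (G : Graph n) (ℓ : ℕ) (λs : Fin ℓ → ℕ)
    → DisjointUnionOfTrees G ℓ λs
    → Decreasing λs
    → (k : ℕ) (κ : Fin (Graph.m G) → Fin k)
    → ProperEdgeColoring G k κ
    → (π : Permutation′ k)
    → HasCycleType (coxeterProduct G κ π) ℓ λs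
lemma3p7 G ℓ λs trees _ k κ _ π = record
  { d = c ; orbits = λ u v → same-tree⇒same-cycle , same-cycle⇒same-tree ; nonempty = nonempty ; size = order }
  where
  open DisjointUnionOfTrees trees
  σ = coxeterProduct G κ π
  L = coxeterOrder G κ π
  σ≗ = coxeterProduct≗edgeProduct G κ π

  same-tree⇒same-cycle : ∀ {u v} → c u ≡ c v → ∃[ t ] (σ ^[ t ]) u ≡ v
  same-tree⇒same-cycle {u} {v} cu≡cv = Reach⇒iterate σ (Reach-cong σ≗
    (forest-edgeProduct-connects G acyclic L (coxeterOrder-unique G κ π) (∈-coxeterOrder G κ π)
                                 (connected u v cu≡cv)))

  same-cycle⇒same-tree : ∀ {u v} → ∃[ t ] (σ ^[ t ]) u ≡ v → c u ≡ c v
  same-cycle⇒same-tree {u} (t , refl) = Reach-invariant σ c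
    (λ x → trans (cong c (σ≗ x)) (edgeProduct-preserves G c noCross L x)) (iterate⇒Reach σ t u)
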